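{- Let $G$ be a connected finite simple graph with minimum degree $\delta(G)>1$. Then the $1$-shunt intersection graph $A_1(G)$ is regular if and only if $G$ is regular, or $G$ is biregular (every vertex has one of exactly two distinct degrees) and $\deg_G(u)+\deg_G(v)$ is the same for every edge $uv$ of $G$.
   Context: A $1$-arc of $G$ is an ordered pair $(u,v)$ with $uv\in E(G)$, written $uv$. A $1$-arc $uv$ can be shunted onto the $1$-arc $vw$ if $w\neq u$ and $vw\in E(G)$. The graph $A_1(G)$ has as vertices the $1$-arcs of $G$ that can be shunted onto some other $1$-arc; two distinct vertices are adjacent iff the corresponding $1$-arcs share at least one vertex of $G$. -}

module Defs where

open import Data.Nat using (ℕ; zero; suc; _+_; _≤_)
open import Data.Bool using (Bool; true; false; _∧_; _∨_; not; if_then_else_)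
open import Data.Fin using (Fin; _≟_)
open import Data.List using (List; map; allFin)
open import Data.Nat.ListAction using (sum)
open import Data.Bool.ListAction using (any)
open import Data.Product using (Σ; ∃; _×_; _,_)
open import Data.Sum using (_⊎_)
open import Relation.Nullary using (¬_)
open import Relation.Nullary.Decidable using (⌊_⌋)
open import Relation.Binary.PropositionalEquality using (_≡_)

record Graph : Set where
  field
    n      : ℕ
    adj    : Fin n → Fin n → Bool
    sym    : ∀ u v → adj u v ≡ adj v u
    irrefl : ∀ u → adj u u ≡ false

module _ (G : Graph) where
  open Graph G

  count : (Fin n → Bool) → ℕ
  count p = sum (map (λ x → if p x then 1 else 0) (allFin n))

  deg : Fin n → ℕ
  deg u = count (adj u)

  data Reach : Fin n → Fin n → Set where
    here : ∀ {u} → Reach u u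
    step : ∀ {u w v} → adj u w ≡ true → Reach w v → Reach u v

  Connected : Set
  Connected = Fin n × (∀ u v → Reach u v)   -- nonempty and every pair joined

  minDegGt1 : Set
  minDegGt1 = ∀ u → 2 ≤ deg u

  Regular : Set
  Regular = ∃ λ k → ∀ u → deg u ≡ k

  Biregular : Set
  Biregular = Σ ℕ λ a → Σ ℕ λ b → ¬ (a ≡ b) ×
    (∀ u → deg u ≡ a ⊎ deg u ≡ b) × (∃ λ u → deg u ≡ a) × (∃ λ u → deg u ≡ b)

  EdgeDegSumConst : Set
  EdgeDegSumConst = ∃ λ s → ∀ u v → adj u v ≡ true → deg u + deg v ≡ s

  -- 1-arc uv is shuntable: uv ∈ E and there is w ≠ u with vw ∈ E
  isA1Vertex : Fin n → Fin n → Bool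
  isA1Vertex u v = adj u v ∧ any (λ w → adj v w ∧ not ⌊ w ≟ u ⌋) (allFin n)

  eqᵇ : Fin n → Fin n → Bool
  eqᵇ x y = ⌊ x ≟ y ⌋

  A1adj : Fin n → Fin n → Fin n → Fin n → Bool
  A1adj u v x y = not (eqᵇ u x ∧ eqᵇ v y)
                ∧ (eqᵇ u x ∨ eqᵇ u y ∨ eqᵇ v x ∨ eqᵇ v y)

  degA1 : Fin n → Fin n → ℕ
  degA1 u v = sum (map (λ x → count (λ y → isA1Vertex x y ∧ A1adj u v x y)) (allFin n))

  A1Regular : Set
  A1Regular = ∃ λ k → ∀ u v → isA1Vertex u v ≡ true → degA1 u v ≡ k

-- When every vertex has degree at least 2, every 1-arc can be shunted, so A₁(G)
-- is the graph on all arcs of G.  An arc uv meets exactly 2(deg u + deg v) − 3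
-- other arcs, hence A₁(G) is regular iff deg u + deg v is the same for every
-- edge.  In a connected graph that condition forces the degrees to alternate
-- between the two values at the ends of a fixed edge along every walk, so G is
-- regular or biregular.
module Submission where

open import Defs
open import Data.Product using (_×_)
open import Data.Sum using (_⊎_)
open import Function.Bundles using (_⇔_)

open import Data.Bool using (Bool; true; false; _∧_; _∨_; not; if_then_else_)
open import Data.Bool.ListAction using (any)
open import Data.Bool.Properties using (∧-identityʳ; ∧-zeroʳ; T-≡; T-∧)
open import Data.Fin using (Fin; zero; suc; _≟_)
open import Data.List using (map; allFin; tabulate)
open import Data.List.Membership.Propositional using (lose)
open import Data.List.Membership.Propositional.Properties using (∈-allFin)
open import Data.List.Properties using (map-tabulate)
open import Data.List.Relation.Unary.Any using (satisfied)
open import Data.List.Relation.Unary.Any.Properties using (any⁺; any⁻)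
open import Data.Nat using (ℕ; _+_; _*_; _∸_; _≤_; z≤n)
import Data.Nat.ListAction as List
open import Data.Nat.Properties
  using (+-0-commutativeMonoid; +-identityʳ; +-assoc; +-comm; +-mono-≤; ≤-refl; <⇒≱;
         +-cancelˡ-≡; *-cancelˡ-≡; m+n∸n≡m; module ≤-Reasoning)
  renaming (_≟_ to _≟ℕ_)
open import Data.Product using (∃; _,_; proj₁; proj₂)
open import Data.Sum as Sum using (inj₁; inj₂)
open import Function using (_∘_)
open import Function.Bundles using (Equivalence; mk⇔)
open import Relation.Nullary using (yes; no; Dec; contradiction)
open import Relation.Nullary.Decidable using (⌊_⌋)
open import Relation.Binary.PropositionalEquality
  using (_≡_; _≢_; refl; sym; trans; cong; cong₂; module ≡-Reasoning)

open import Algebra.Properties.CommutativeMonoid.Sum +-0-commutativeMonoid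
  using (sum; sum-syntax; sum-cong-≗; sum-replicate-zero; ∑-distrib-+)

[_] : Bool → ℕ
[ b ] = if b then 1 else 0

δ[_]_ : ∀ {m} → Fin m → ℕ → Fin m → ℕ
(δ[ i ] c) j = if ⌊ i ≟ j ⌋ then c else 0

sum-map-allFin : ∀ {m} (f : Fin m → ℕ) → List.sum (map f (allFin m)) ≡ ∑[ i < m ] f i
sum-map-allFin f = trans (cong List.sum (map-tabulate (λ i → i) f)) (sum-tabulate f)
  where
  sum-tabulate : ∀ {m} (f : Fin m → ℕ) → List.sum (tabulate f) ≡ sum f
  sum-tabulate {ℕ.zero}  f = refl
  sum-tabulate {ℕ.suc m} f = cong (f zero +_) (sum-tabulate (λ i → f (suc i)))

δ-diag : ∀ {m} (i : Fin m) c → (δ[ i ] c) i ≡ c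
δ-diag i c with i ≟ i
... | yes _   = refl
... | no  i≢i = contradiction refl i≢i

δ-off : ∀ {m} {i j : Fin m} → i ≢ j → ∀ c → (δ[ i ] c) j ≡ 0
δ-off {i = i} {j} i≢j c with i ≟ j
... | yes i≡j = contradiction i≡j i≢j
... | no  _   = refl

∑-δ : ∀ {m} (i : Fin m) c → sum (δ[ i ] c) ≡ c
∑-δ {ℕ.suc m} zero    c = trans (cong (c +_) (sum-replicate-zero m)) (+-identityʳ c)
∑-δ {ℕ.suc m} (suc i) c = trans (sum-cong-≗ shift) (∑-δ i c)
  where
  shift : ∀ j → (δ[ suc i ] c) (suc j) ≡ (δ[ i ] c) j
  shift j with i ≟ j
  ... | yes _ = refl
  ... | no  _ = refl

∑-mono-≤ : ∀ {m} {f g : Fin m → ℕ} → (∀ i → f i ≤ g i) → sum f ≤ sum g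
∑-mono-≤ {ℕ.zero}  f≤g = z≤n
∑-mono-≤ {ℕ.suc m} f≤g = +-mono-≤ (f≤g zero) (∑-mono-≤ (λ i → f≤g (suc i)))

any-allFin-false : ∀ {m} (p : Fin m → Bool) → any p (allFin m) ≡ false → ∀ i → p i ≡ false
any-allFin-false p none i with p i in pi
... | false = refl
... | true  =
  trans (sym (Equivalence.to T-≡ (any⁺ p (lose (∈-allFin i) (Equivalence.from T-≡ pi))))) none

module _ (G : Graph) where
  open Graph G using (n; adj) renaming (sym to adj-sym; irrefl to adj-irrefl)

  deg≡∑ : ∀ u → deg G u ≡ ∑[ w < n ] [ adj u w ]
  deg≡∑ u = sum-map-allFin (λ w → [ adj u w ])

  deg≡∑-in : ∀ u → deg G u ≡ ∑[ w < n ] [ adj w u ]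
  deg≡∑-in u = trans (deg≡∑ u) (sum-cong-≗ (λ w → cong [_] (adj-sym u w)))

  deg≤1 : ∀ {u v} → (∀ w → adj v w ≡ true → w ≡ u) → deg G v ≤ 1
  deg≤1 {u} {v} only-u = begin
    deg G v                   ≡⟨ deg≡∑ v ⟩
    ∑[ w < n ] [ adj v w ]    ≤⟨ ∑-mono-≤ bound ⟩
    sum (δ[ u ] 1)            ≡⟨ ∑-δ u 1 ⟩
    1                         ∎
    where
    open ≤-Reasoning
    bound : ∀ w → [ adj v w ] ≤ (δ[ u ] 1) w
    bound w with adj v w in vw | u ≟ w
    ... | false | _        = z≤n
    ... | true  | yes _    = ≤-refl
    ... | true  | no  u≢w  = contradiction (sym (only-u w vw)) u≢w

  has-onward-neighbour : ∀ {v} → 2 ≤ deg G v → ∀ u →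
                         any (λ w → adj v w ∧ not ⌊ w ≟ u ⌋) (allFin n) ≡ true
  has-onward-neighbour {v} 2≤dv u with any (λ w → adj v w ∧ not ⌊ w ≟ u ⌋) (allFin n) in none
  ... | true  = refl
  ... | false = contradiction (deg≤1 only-u) (<⇒≱ 2≤dv)
    where
    only-u : ∀ w → adj v w ≡ true → w ≡ u
    only-u w vw with w ≟ u | any-allFin-false _ none w
    ... | yes w≡u | _   = w≡u
    ... | no  _   | vw∧true≡false
      = contradiction (trans (sym vw) (trans (sym (∧-identityʳ _)) vw∧true≡false)) λ ()

  isA1Vertex≡adj : minDegGt1 G → ∀ u v → isA1Vertex G u v ≡ adj u v
  isA1Vertex≡adj δ>1 u v rewrite has-onward-neighbour (δ>1 v) u = ∧-identityʳ (adj u v)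

  neighbour : ∀ {v} → 2 ≤ deg G v → ∃ λ w → adj v w ≡ true
  neighbour {v} 2≤dv
    with w , t ← satisfied (any⁻ _ (allFin n) (Equivalence.from T-≡ (has-onward-neighbour 2≤dv v)))
    = w , Equivalence.to T-≡ (proj₁ (Equivalence.to T-∧ t))

  adj⇒≢ : ∀ {u v} → adj u v ≡ true → u ≢ v
  adj⇒≢ {u} uv refl = contradiction (trans (sym uv) (adj-irrefl u)) λ ()

  A1adj-tail : ∀ u v y → A1adj G u v u y ≡ not ⌊ v ≟ y ⌋
  A1adj-tail u v y with u ≟ u
  ... | yes _   = ∧-identityʳ _
  ... | no  u≢u = contradiction refl u≢u

  A1adj-head : ∀ {u v} → u ≢ v → ∀ y → A1adj G u v v y ≡ true
  A1adj-head {u} {v} u≢v y with u ≟ v | v ≟ v | u ≟ y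
  ... | yes u≡v | _       | _     = contradiction u≡v u≢v
  ... | no  _   | no  v≢v | _     = contradiction refl v≢v
  ... | no  _   | yes _   | yes _ = refl
  ... | no  _   | yes _   | no  _ = refl

  A1adj-other : ∀ {u v x} → x ≢ u → x ≢ v → ∀ y → A1adj G u v x y ≡ ⌊ u ≟ y ⌋ ∨ ⌊ v ≟ y ⌋
  A1adj-other {u} {v} {x} x≢u x≢v y with u ≟ x | v ≟ x
  ... | yes u≡x | _       = contradiction (sym u≡x) x≢u
  ... | no  _   | yes v≡x = contradiction (sym v≡x) x≢v
  ... | no  _   | no  _   = refl

  arcsMeetingFrom : Fin n → Fin n → Fin n → ℕ
  arcsMeetingFrom u v x = ∑[ y < n ] [ adj x y ∧ A1adj G u v x y ]

  arcsMeetingFrom-tail : ∀ {u v} → adj u v ≡ true → arcsMeetingFrom u v u + 1 ≡ deg G u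
  arcsMeetingFrom-tail {u} {v} uv = begin
    arcsMeetingFrom u v u + 1
      ≡⟨ cong (arcsMeetingFrom u v u +_) (sym (∑-δ v 1)) ⟩
    arcsMeetingFrom u v u + sum (δ[ v ] 1)
      ≡⟨ sym (∑-distrib-+ (λ y → [ adj u y ∧ A1adj G u v u y ]) (δ[ v ] 1)) ⟩
    ∑[ y < n ] ([ adj u y ∧ A1adj G u v u y ] + (δ[ v ] 1) y)
      ≡⟨ sum-cong-≗ pointwise ⟩
    ∑[ y < n ] [ adj u y ]
      ≡⟨ sym (deg≡∑ u) ⟩
    deg G u
      ∎
    where
    open ≡-Reasoning
    pointwise : ∀ y → [ adj u y ∧ A1adj G u v u y ] + (δ[ v ] 1) y ≡ [ adj u y ]
    pointwise y rewrite A1adj-tail u v y with v ≟ y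
    ... | yes refl rewrite uv = refl
    ... | no  _    rewrite ∧-identityʳ (adj u y) = +-identityʳ _

  arcsMeetingFrom-head : ∀ {u v} → adj u v ≡ true → arcsMeetingFrom u v v ≡ deg G v
  arcsMeetingFrom-head {u} {v} uv = trans (sum-cong-≗ pointwise) (sym (deg≡∑ v))
    where
    pointwise : ∀ y → [ adj v y ∧ A1adj G u v v y ] ≡ [ adj v y ]
    pointwise y = trans (cong (λ b → [ adj v y ∧ b ]) (A1adj-head (adj⇒≢ uv) y))
                        (cong [_] (∧-identityʳ _))

  arcsMeetingFrom-other : ∀ {u v x} → u ≢ v → x ≢ u → x ≢ v →
                          arcsMeetingFrom u v x ≡ [ adj x u ] + [ adj x v ]
  arcsMeetingFrom-other {u} {v} {x} u≢v x≢u x≢v = begin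
    arcsMeetingFrom u v x
      ≡⟨ sum-cong-≗ pointwise ⟩
    ∑[ y < n ] ((δ[ u ] [ adj x u ]) y + (δ[ v ] [ adj x v ]) y)
      ≡⟨ ∑-distrib-+ (δ[ u ] [ adj x u ]) (δ[ v ] [ adj x v ]) ⟩
    sum (δ[ u ] [ adj x u ]) + sum (δ[ v ] [ adj x v ])
      ≡⟨ cong₂ _+_ (∑-δ u _) (∑-δ v _) ⟩
    [ adj x u ] + [ adj x v ]
      ∎
    where
    open ≡-Reasoning
    pointwise : ∀ y → [ adj x y ∧ A1adj G u v x y ]
                      ≡ (δ[ u ] [ adj x u ]) y + (δ[ v ] [ adj x v ]) y
    pointwise y rewrite A1adj-other x≢u x≢v y with u ≟ y | v ≟ y
    ... | yes refl | yes refl = contradiction refl u≢v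
    ... | yes refl | no  _    = trans (cong [_] (∧-identityʳ _)) (sym (+-identityʳ _))
    ... | no  _    | yes refl = cong [_] (∧-identityʳ _)
    ... | no  _    | no  _    = cong [_] (∧-zeroʳ (adj x y))

  -- Row x of the count is deg u − 1 for x = u (every arc out of u except uv),
  -- deg v for x = v, and [x ~ u] + [x ~ v] otherwise; the δ terms make this uniform.
  arcsMeetingFrom-δ : ∀ {u v} → adj u v ≡ true → ∀ x →
    arcsMeetingFrom u v x + (δ[ u ] 2) x + (δ[ v ] 1) x
    ≡ (δ[ u ] (deg G u)) x + (δ[ v ] (deg G v)) x + ([ adj x u ] + [ adj x v ])
  arcsMeetingFrom-δ {u} {v} uv x = by-cases x (x ≟ u) (x ≟ v)
    where
    by-cases : ∀ x → Dec (x ≡ u) → Dec (x ≡ v) →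
      arcsMeetingFrom u v x + (δ[ u ] 2) x + (δ[ v ] 1) x
      ≡ (δ[ u ] (deg G u)) x + (δ[ v ] (deg G v)) x + ([ adj x u ] + [ adj x v ])
    by-cases x (yes refl) (yes x≡v) = contradiction x≡v (adj⇒≢ uv)
    by-cases x (yes refl) (no u≢v)
      rewrite δ-diag u 2 | δ-off (u≢v ∘ sym) 1 | δ-diag u (deg G u) | δ-off (u≢v ∘ sym) (deg G v)
            | adj-irrefl u | uv | +-identityʳ (arcsMeetingFrom u v u + 2) | +-identityʳ (deg G u)
      = trans (sym (+-assoc (arcsMeetingFrom u v u) 1 1)) (cong (_+ 1) (arcsMeetingFrom-tail uv))
    by-cases x (no v≢u) (yes refl)
      rewrite δ-off (v≢u ∘ sym) 2 | δ-diag v 1 | δ-off (v≢u ∘ sym) (deg G u) | δ-diag v (deg G v)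
            | adj-irrefl v | trans (adj-sym v u) uv | +-identityʳ (arcsMeetingFrom u v v)
      = cong (_+ 1) (arcsMeetingFrom-head uv)
    by-cases x (no x≢u) (no x≢v)
      rewrite δ-off (x≢u ∘ sym) 2 | δ-off (x≢v ∘ sym) 1 | δ-off (x≢u ∘ sym) (deg G u)
            | δ-off (x≢v ∘ sym) (deg G v) | +-identityʳ (arcsMeetingFrom u v x)
            | +-identityʳ (arcsMeetingFrom u v x)
      = arcsMeetingFrom-other (adj⇒≢ uv) x≢u x≢v

  arcsMeeting : Fin n → Fin n → ℕ
  arcsMeeting u v = ∑[ x < n ] arcsMeetingFrom u v x

  arcsMeeting-+3 : ∀ {u v} → adj u v ≡ true → arcsMeeting u v + 3 ≡ 2 * (deg G u + deg G v)
  arcsMeeting-+3 {u} {v} uv = begin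
    arcsMeeting u v + 3
      ≡⟨ cong (arcsMeeting u v +_) (sym (cong₂ _+_ (∑-δ u 2) (∑-δ v 1))) ⟩
    sum row + (sum (δ[ u ] 2) + sum (δ[ v ] 1))
      ≡⟨ sym (+-assoc (sum row) _ _) ⟩
    sum row + sum (δ[ u ] 2) + sum (δ[ v ] 1)
      ≡⟨ cong (_+ sum (δ[ v ] 1)) (sym (∑-distrib-+ row (δ[ u ] 2))) ⟩
    ∑[ x < n ] (row x + (δ[ u ] 2) x) + sum (δ[ v ] 1)
      ≡⟨ sym (∑-distrib-+ (λ x → row x + (δ[ u ] 2) x) (δ[ v ] 1)) ⟩
    ∑[ x < n ] (row x + (δ[ u ] 2) x + (δ[ v ] 1) x)
      ≡⟨ sum-cong-≗ (arcsMeetingFrom-δ uv) ⟩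
    ∑[ x < n ] ((δ[ u ] du) x + (δ[ v ] dv) x + ([ adj x u ] + [ adj x v ]))
      ≡⟨ ∑-distrib-+ (λ x → (δ[ u ] du) x + (δ[ v ] dv) x) (λ x → [ adj x u ] + [ adj x v ]) ⟩
    ∑[ x < n ] ((δ[ u ] du) x + (δ[ v ] dv) x) + ∑[ x < n ] ([ adj x u ] + [ adj x v ])
      ≡⟨ cong₂ _+_ (∑-distrib-+ (δ[ u ] du) (δ[ v ] dv))
                   (∑-distrib-+ (λ x → [ adj x u ]) (λ x → [ adj x v ])) ⟩
    (sum (δ[ u ] du) + sum (δ[ v ] dv)) + (∑[ x < n ] [ adj x u ] + ∑[ x < n ] [ adj x v ])
      ≡⟨ cong₂ _+_ (cong₂ _+_ (∑-δ u du) (∑-δ v dv))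
                   (sym (cong₂ _+_ (deg≡∑-in u) (deg≡∑-in v))) ⟩
    (du + dv) + (du + dv)
      ≡⟨ cong ((du + dv) +_) (sym (+-identityʳ (du + dv))) ⟩
    2 * (du + dv)
      ∎
    where
    open ≡-Reasoning
    du dv : ℕ
    du = deg G u
    dv = deg G v
    row : Fin n → ℕ
    row = arcsMeetingFrom u v

  degA1≡arcsMeeting : minDegGt1 G → ∀ u v → degA1 G u v ≡ arcsMeeting u v
  degA1≡arcsMeeting δ>1 u v =
    trans (sum-map-allFin (λ x → count G (λ y → isA1Vertex G x y ∧ A1adj G u v x y)))
      (sum-cong-≗ λ x → trans (sum-map-allFin (λ y → [ isA1Vertex G x y ∧ A1adj G u v x y ]))
        (sum-cong-≗ λ y →
        cong (λ b → [ b ∧ A1adj G u v x y ]) (isA1Vertex≡adj δ>1 x y)))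

  degA1-+3 : minDegGt1 G → ∀ {u v} → adj u v ≡ true → degA1 G u v + 3 ≡ 2 * (deg G u + deg G v)
  degA1-+3 δ>1 {u} {v} uv = trans (cong (_+ 3) (degA1≡arcsMeeting δ>1 u v)) (arcsMeeting-+3 uv)

  A1Regular⇔EdgeDegSumConst : minDegGt1 G → Fin n → A1Regular G ⇔ EdgeDegSumConst G
  A1Regular⇔EdgeDegSumConst δ>1 r = mk⇔ to from
    where
    arc : ∀ {u v} → adj u v ≡ true → isA1Vertex G u v ≡ true
    arc {u} {v} uv = trans (isA1Vertex≡adj δ>1 u v) uv

    to : A1Regular G → EdgeDegSumConst G
    to (k , hk) with w , rw ← neighbour (δ>1 r) = deg G r + deg G w , λ u v uv →
      *-cancelˡ-≡ _ _ 2 (begin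
        2 * (deg G u + deg G v)  ≡⟨ sym (degA1-+3 δ>1 uv) ⟩
        degA1 G u v + 3          ≡⟨ cong (_+ 3) (trans (hk u v (arc uv)) (sym (hk r w (arc rw)))) ⟩
        degA1 G r w + 3          ≡⟨ degA1-+3 δ>1 rw ⟩
        2 * (deg G r + deg G w)  ∎)
      where open ≡-Reasoning

    from : EdgeDegSumConst G → A1Regular G
    from (s , hs) = 2 * s ∸ 3 , λ u v a1 →
      let uv = trans (sym (isA1Vertex≡adj δ>1 u v)) a1 in begin
        degA1 G u v                    ≡⟨ sym (m+n∸n≡m (degA1 G u v) 3) ⟩
        degA1 G u v + 3 ∸ 3            ≡⟨ cong (_∸ 3) (degA1-+3 δ>1 uv) ⟩
        2 * (deg G u + deg G v) ∸ 3    ≡⟨ cong (λ t → 2 * t ∸ 3) (hs u v uv) ⟩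
        2 * s ∸ 3                      ∎
      where open ≡-Reasoning

  Regular⇒EdgeDegSumConst : Regular G → EdgeDegSumConst G
  Regular⇒EdgeDegSumConst (k , hk) = k + k , λ u v _ → cong₂ _+_ (hk u) (hk v)

  deg∈ends : (∀ x y → Reach G x y) → EdgeDegSumConst G → ∀ {r w} → adj r w ≡ true →
             ∀ x → deg G x ≡ deg G r ⊎ deg G x ≡ deg G w
  deg∈ends reach (s , hs) {r} {w} rw x = along (reach r x) (inj₁ refl)
    where
    other-end : ∀ {a b y z} → a + b ≡ s → adj y z ≡ true → deg G y ≡ a → deg G z ≡ b
    other-end {a} {b} {y} {z} ab yz dy≡a =
      +-cancelˡ-≡ a _ _ (trans (cong (_+ deg G z) (sym dy≡a)) (trans (hs y z yz) (sym ab)))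

    along : ∀ {y z} → Reach G y z → deg G y ≡ deg G r ⊎ deg G y ≡ deg G w →
            deg G z ≡ deg G r ⊎ deg G z ≡ deg G w
    along here                 dy         = dy
    along (step yz walk) (inj₁ dy≡a) = along walk (inj₂ (other-end (hs r w rw) yz dy≡a))
    along (step yz walk) (inj₂ dy≡b) =
      along walk (inj₁ (other-end (trans (+-comm (deg G w) (deg G r)) (hs r w rw)) yz dy≡b))

  regular⊎biregular : Connected G → minDegGt1 G → EdgeDegSumConst G → Regular G ⊎ Biregular G
  regular⊎biregular (r , reach) δ>1 c with w , rw ← neighbour (δ>1 r) with deg G r ≟ℕ deg G w
  ... | yes dr≡dw =
    inj₁ (deg G r , λ x → Sum.reduce (Sum.map₂ (λ e → trans e (sym dr≡dw)) (deg∈ends reach c rw x)))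
  ... | no  dr≢dw = inj₂ (deg G r , deg G w , dr≢dw , deg∈ends reach c rw , (r , refl) , (w , refl))

mainTheorem9 : (G : Graph) → Connected G → minDegGt1 G →
    (A1Regular G ⇔ (Regular G ⊎ (Biregular G × EdgeDegSumConst G)))
mainTheorem9 G conn@(r , _) δ>1 = mk⇔
  (λ a1 → let c = to a1 in Sum.map₂ (_, c) (regular⊎biregular G conn δ>1 c))
  (Sum.reduce ∘ Sum.map (from ∘ Regular⇒EdgeDegSumConst G) (from ∘ proj₂))
  where open Equivalence (A1Regular⇔EdgeDegSumConst G δ>1 r)
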